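{- Let $q$ be a prime power, $\alpha$ a primitive element of $\mathbb{F}_q$, and let $\mathcal{A}$ be a $1$-spread of $\mathbb{F}_q^4$ (a set of $q^2+1$ two-dimensional subspaces of $\mathbb{F}_q^4$ such that every nonzero vector lies in exactly one of them). For each $X\in\mathcal{A}$ fix a basis $(x_1,x_2)$ of $X$. Let $C$ be an extension code, i.e. a $2$-dimensional linear subspace of the space of $2\times(q+1)$ matrices over $\mathbb{F}_q$ such that every $Z\in C$ with columns $z_1,\ldots,z_{q+1}$ satisfies $z_i=\alpha^{i-3}z_1+z_2$ for $3\le i\le q+1$, and for each $i$ the $i$-th columns of the $q^2$ matrices of $C$ are all the $q^2$ vectors of $\mathbb{F}_q^2$. For $X\in\mathcal{A}$ and $Z\in C$ let $X_Z=\mathrm{span}\{(x_1,z_1),(x_2,z_2)\}\subseteq\mathbb{F}_q^6$, where $(x,z)$ denotes concatenation of $x\in\mathbb{F}_q^4$ and $z\in\mathbb{F}_q^2$. Then $$\{\mathrm{span}\{e_5,e_6\}\}\cup\{X_Z : X\in\mathcal{A},\ Z\in C\}$$ is a $1$-spread of $\mathbb{F}_q^6$ (it consists of $q^4+q^2+1$ two-dimensional subspaces and every nonzero vector of $\mathbb{F}_q^6$ lies in exactly one of them), where $e_5,e_6$ are the unit vectors of $\mathbb{F}_q^6$ with a one in coordinate $5$, respectively $6$.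
   Context: $\mathbb{F}_q$ is the finite field with $q$ elements and a primitive element is a generator of its multiplicative group. In the paper, for $X\in\mathcal{A}$ the columns $v_1,\ldots,v_{q+1}$ of its representation satisfy $v_i=\alpha^{i-3}v_1+v_2$, and $X$ is extended by $Z\in C$ by stacking $Z$ under this $4\times(q+1)$ matrix; the resulting subspace is $X_Z$ with $x_1=v_1,x_2=v_2$. -}

module Defs where

open import Level using (_⊔_)
open import Algebra.Bundles using (CommutativeRing)
open import Data.Nat using (ℕ; zero; suc; _∸_; _≤_)
import Data.Nat as ℕ
open import Data.Nat.Primality using (Prime)
open import Data.Fin using (Fin; toℕ)
open import Data.Product using (Σ; ∃; ∃₂; _×_; _,_; proj₁; proj₂)
open import Data.Sum using (_⊎_)
open import Data.Vec.Functional using (_++_)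
open import Relation.Nullary using (¬_)
open import Function.Bundles using (Bijection)
import Relation.Binary.PropositionalEquality as ≡
open ≡ using (_≡_)

IsPrimePower : ℕ → Set
IsPrimePower q = ∃₂ λ p k → Prime p × q ≡ p ℕ.^ suc k

module FieldDefs {c ℓ} (R : CommutativeRing c ℓ) where
  open CommutativeRing R

  IsField : Set (c ⊔ ℓ)
  IsField = (¬ (1# ≈ 0#)) × (∀ x → ¬ (x ≈ 0#) → ∃ λ y → x * y ≈ 1#)

  HasCard : ℕ → Set (c ⊔ ℓ)
  HasCard q = Bijection (≡.setoid (Fin q)) setoid

  pow : Carrier → ℕ → Carrier
  pow x zero = 1#
  pow x (suc k) = x * pow x k

  IsPrimitive : Carrier → Set (c ⊔ ℓ)
  IsPrimitive α = (¬ (α ≈ 0#)) × (∀ x → ¬ (x ≈ 0#) → ∃ λ k → x ≈ pow α k)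

  Vect : ℕ → Set c
  Vect n = Fin n → Carrier

  Nonzero : ∀ {n} → Vect n → Set ℓ
  Nonzero v = ¬ (∀ j → v j ≈ 0#)

  Pair : ℕ → Set c
  Pair n = Vect n × Vect n

  Indep : ∀ {n} → Pair n → Set (c ⊔ ℓ)
  Indep (x , y) = ∀ a b → (∀ j → a * x j + b * y j ≈ 0#) → (a ≈ 0#) × (b ≈ 0#)

  InSpan : ∀ {n} → Vect n → Pair n → Set (c ⊔ ℓ)
  InSpan v (x , y) = ∃₂ λ a b → ∀ j → v j ≈ a * x j + b * y j

  SameSpan : ∀ {n} → Pair n → Pair n → Set (c ⊔ ℓ)
  SameSpan P Q = ∀ v → (InSpan v P → InSpan v Q) × (InSpan v Q → InSpan v P)

  -- the N subspaces span(S k) (each 2-dimensional, given by a basis S k)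
  -- form a 1-spread of R^n: every nonzero vector lies in exactly one of them
  -- (so in particular they are pairwise distinct, hence N of them).
  IsSpread : (n N : ℕ) → (Fin N → Pair n) → Set (c ⊔ ℓ)
  IsSpread n N S =
    (∀ k → Indep (S k)) ×
    (∀ v → Nonzero v → ∃ λ k → InSpan v (S k) × (∀ k' → InSpan v (S k') → k' ≡ k))

  -- 2 × (q+1) matrices: Z r i = entry in row r, column i (columns 0-based)
  Mat : ℕ → Set c
  Mat q = Fin 2 → Fin (suc q) → Carrier

  lin : ∀ {q} → Mat q → Mat q → Carrier → Carrier → Mat q
  lin B₁ B₂ a b r i = a * B₁ r i + b * B₂ r i

  column : ∀ {q} → Mat q → Fin (suc q) → Vect 2
  column Z i r = Z r i

  -- C = span{B₁ , B₂} is an extension code (w.r.t. α):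
  --   B₁ , B₂ linearly independent (C is 2-dimensional),
  --   every Z ∈ C satisfies z_i = α^(i-3) z_1 + z_2 for 3 ≤ i ≤ q+1
  --   (0-based column k = i - 1, so exponent toℕ k ∸ 2 for toℕ k ≥ 2),
  --   and for each i the i-th columns of the elements of C are all of R^2.
  IsExtensionCode : (q : ℕ) → Carrier → Mat q → Mat q → Set (c ⊔ ℓ)
  IsExtensionCode q α B₁ B₂ =
    (∀ a b → (∀ r i → lin B₁ B₂ a b r i ≈ 0#) → (a ≈ 0#) × (b ≈ 0#)) ×
    (∀ a b → ∀ (i₁ i₂ k : Fin (suc q)) → toℕ i₁ ≡ 0 → toℕ i₂ ≡ 1 → 2 ≤ toℕ k →
       ∀ r → lin B₁ B₂ a b r k ≈ pow α (toℕ k ∸ 2) * lin B₁ B₂ a b r i₁ + lin B₁ B₂ a b r i₂) ×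
    (∀ (i : Fin (suc q)) (v : Vect 2) → ∃₂ λ a b → ∀ r → column (lin B₁ B₂ a b) i r ≈ v r)

  -- X_Z = span{(x₁ , z₁) , (x₂ , z₂)} for X with basis (x₁ , x₂) and
  -- Z = a B₁ + b B₂ ∈ C, where i₁ , i₂ are the first two columns
  extend : ∀ {q} → Pair 4 → Mat q → (i₁ i₂ : Fin (suc q)) → Pair 6
  extend (x₁ , x₂) Z i₁ i₂ = (x₁ ++ column Z i₁) , (x₂ ++ column Z i₂)

  e₅ : Vect 6
  e₅ j with toℕ j
  ... | 4 = 1#
  ... | _ = 0#

  e₆ : Vect 6
  e₆ j with toℕ j
  ... | 5 = 1#
  ... | _ = 0#

  -- The set {span{e₅,e₆}} ∪ {X_Z : X ∈ A, Z ∈ C} is a 1-spread of R^6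
  -- consisting of q^4 + q^2 + 1 subspaces: it is enumerated (without
  -- repetition, as IsSpread forces distinctness) by some S.
  ExtendedIsSpread : (q : ℕ) → (Fin (q ℕ.^ 2 ℕ.+ 1) → Pair 4) → Mat q → Mat q →
                     (i₁ i₂ : Fin (suc q)) → Set (c ⊔ ℓ)
  ExtendedIsSpread q A B₁ B₂ i₁ i₂ =
    ∃ λ (S : Fin (q ℕ.^ 4 ℕ.+ q ℕ.^ 2 ℕ.+ 1) → Pair 6) →
      IsSpread 6 (q ℕ.^ 4 ℕ.+ q ℕ.^ 2 ℕ.+ 1) S ×
      (∀ k → SameSpan (S k) (e₅ , e₆) ⊎
             (∃ λ X → ∃₂ λ a b → SameSpan (S k) (extend (A X) (lin B₁ B₂ a b) i₁ i₂))) ×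
      (∃ λ k → SameSpan (S k) (e₅ , e₆)) ×
      (∀ X a b → ∃ λ k → SameSpan (S k) (extend (A X) (lin B₁ B₂ a b) i₁ i₂))

module Submission where

-- Write v ∈ 𝔽⁶ as (u , w) with u ∈ 𝔽⁴ and w ∈ 𝔽². If u = 0 then v lies in
-- span{e₅ , e₆} and in no X_Z, since the 𝔽⁴-part of a nonzero vector of X_Z is
-- a nonzero vector of X. If u ≠ 0 then u lies in exactly one X ∈ 𝒜, as
-- u = a x₁ + b x₂ with (a , b) ≠ 0 unique, and v ∈ X_Z iff w = a z₁ + b z₂.
-- Writing a / b = α^m with m ≤ q - 2 (the cases a = 0 or b = 0 are direct), the
-- extension rule gives a z₁ + b z₂ = b z_(m+2); since the (m+2)-th columns of
-- the codewords run through 𝔽² exactly once, exactly one Z ∈ C works.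

open import Defs
open import Algebra.Bundles using (CommutativeRing; RawRing)
open import Algebra.Solver.Ring.AlmostCommutativeRing using (fromCommutativeRing; _-Raw-AlmostCommutative⟶_)
open import Data.Empty using (⊥-elim)
open import Data.Fin as Fin using (Fin; toℕ; fromℕ<; punchOut; join; splitAt; _↑ˡ_; _↑ʳ_)
open import Data.Fin.Patterns using (0F; 1F; 2F; 3F)
open import Data.Fin.Properties using (pigeonhole; punchOut-injective; toℕ<n; toℕ-fromℕ<; join-splitAt; all?; +↔⊎; *↔×; 1↔⊤)
open import Data.Maybe using (Maybe; just; nothing)
open import Data.Nat as ℕ using (ℕ; zero; suc; _≤_; _<_; z≤n; s≤s)
open import Data.Nat.Properties using (n<1+n; ≤-trans; m≤n⇒m<n∨m≡n)
open import Data.Product using (∃; ∃₂; _×_; _,_; proj₁; proj₂; swap)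
open import Data.Product.Function.NonDependent.Propositional using (_×-↔_)
open import Data.Sum using (_⊎_; inj₁; inj₂; [_,_])
open import Data.Sum.Function.Propositional using (_⊎-↔_)
open import Data.Unit using (⊤; tt)
open import Data.Vec.Functional using (_++_; take; drop; _∷_; [])
open import Data.Vec.Functional.Properties using (lookup-++ˡ; lookup-++ʳ)
open import Function.Base using (_∘_)
open import Function.Bundles using (Bijection; Inverse; _↔_)
open import Function.Properties.Inverse using (↔-refl; ↔-trans)
open import Level using (0ℓ; _⊔_)
open import Relation.Binary.Definitions using (Decidable)
open import Relation.Binary.PropositionalEquality as ≡ using (_≡_; _≢_)
open import Relation.Nullary using (¬_; yes; no)

-- Algebra.Solver.Ring needs a coefficient ring with a zero test that maps into
-- R; the integers do, encoded as pairs (m , n) standing for m - n. No normal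
-- form is needed since coefficients are compared by m + n′ ≡ m′ + n.
module IntegerCoefficientSolver {c ℓ} (R : CommutativeRing c ℓ) where
  open CommutativeRing R
  open import Algebra.Properties.AbelianGroup +-abelianGroup using (⁻¹-∙-comm; ⁻¹-anti-homo‿-)
  open import Algebra.Properties.CommutativeSemigroup +-commutativeSemigroup using (interchange)
  open import Algebra.Properties.Ring ring using ([y-z]x≈yx-zx; x[y-z]≈xy-xz)
  open import Algebra.Properties.Semiring.Mult semiring using (×-homo-+; ×1-homo-*) renaming (_×_ to _×ᵣ_)
  open import Relation.Binary.Reasoning.Setoid setoid

  private
    ℤ-rawRing : RawRing 0ℓ 0ℓ
    ℤ-rawRing = record
      { Carrier = ℕ × ℕ
      ; _≈_ = _≡_
      ; _+_ = λ (a , b) (c , d) → (a ℕ.+ c , b ℕ.+ d)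
      ; _*_ = λ (a , b) (c , d) → (a ℕ.* c ℕ.+ b ℕ.* d , a ℕ.* d ℕ.+ b ℕ.* c)
      ; -_ = swap
      ; 0# = (0 , 0)
      ; 1# = (1 , 0)
      }

    ι : ℕ → Carrier
    ι n = n ×ᵣ 1#

    ⟦_⟧ℤ : ℕ × ℕ → Carrier
    ⟦ m , n ⟧ℤ = ι m - ι n

    -‿+-interchange : ∀ x y z w → (x + z) - (y + w) ≈ (x - y) + (z - w)
    -‿+-interchange x y z w = sym (trans (interchange x (- y) z (- w)) (+-congˡ (⁻¹-∙-comm y w)))

    x+z-[y+z]≈x-y : ∀ x y z → (x + z) - (y + z) ≈ x - y
    x+z-[y+z]≈x-y x y z = begin
      (x + z) - (y + z) ≈⟨ -‿+-interchange x y z z ⟩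
      (x - y) + (z - z) ≈⟨ +-congˡ (-‿inverseʳ z) ⟩
      (x - y) + 0#      ≈⟨ +-identityʳ _ ⟩
      x - y             ∎

    [x-y][z-w]≈xz+yw-[xw+yz] : ∀ x y z w → (x - y) * (z - w) ≈ (x * z + y * w) - (x * w + y * z)
    [x-y][z-w]≈xz+yw-[xw+yz] x y z w = begin
      (x - y) * (z - w)                 ≈⟨ [y-z]x≈yx-zx (z - w) x y ⟩
      x * (z - w) - y * (z - w)         ≈⟨ +-cong (x[y-z]≈xy-xz x z w) (-‿cong (x[y-z]≈xy-xz y z w)) ⟩
      (x * z - x * w) - (y * z - y * w) ≈⟨ +-congˡ (⁻¹-anti-homo‿- (y * z) (y * w)) ⟩
      (x * z - x * w) + (y * w - y * z) ≈⟨ -‿+-interchange (x * z) (x * w) (y * w) (y * z) ⟨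
      (x * z + y * w) - (x * w + y * z) ∎

    ι-homo-+ : ∀ m n → ι (m ℕ.+ n) ≈ ι m + ι n
    ι-homo-+ = ×-homo-+ 1#

    morphism : ℤ-rawRing -Raw-AlmostCommutative⟶ fromCommutativeRing R
    morphism = record
      { ⟦_⟧ = ⟦_⟧ℤ
      ; +-homo = λ (a , b) (c , d) → begin
          ι (a ℕ.+ c) - ι (b ℕ.+ d) ≈⟨ +-cong (ι-homo-+ a c) (-‿cong (ι-homo-+ b d)) ⟩
          (ι a + ι c) - (ι b + ι d) ≈⟨ -‿+-interchange (ι a) (ι b) (ι c) (ι d) ⟩
          (ι a - ι b) + (ι c - ι d) ∎
      ; *-homo = λ (a , b) (c , d) → begin
          ι (a ℕ.* c ℕ.+ b ℕ.* d) - ι (a ℕ.* d ℕ.+ b ℕ.* c)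
            ≈⟨ +-cong (trans (ι-homo-+ (a ℕ.* c) (b ℕ.* d)) (+-cong (×1-homo-* a c) (×1-homo-* b d)))
                      (-‿cong (trans (ι-homo-+ (a ℕ.* d) (b ℕ.* c)) (+-cong (×1-homo-* a d) (×1-homo-* b c)))) ⟩
          (ι a * ι c + ι b * ι d) - (ι a * ι d + ι b * ι c) ≈⟨ [x-y][z-w]≈xz+yw-[xw+yz] (ι a) (ι b) (ι c) (ι d) ⟨
          (ι a - ι b) * (ι c - ι d) ∎
      ; -‿homo = λ (a , b) → sym (⁻¹-anti-homo‿- (ι a) (ι b))
      ; 0-homo = -‿inverseʳ 0#
      ; 1-homo = trans (+-assoc 1# 0# (- 0#)) (trans (+-congˡ (-‿inverseʳ 0#)) (+-identityʳ 1#))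
      }

    _≟ℤ_ : ∀ x y → Maybe (⟦ x ⟧ℤ ≈ ⟦ y ⟧ℤ)
    (m , n) ≟ℤ (m′ , n′) with m ℕ.+ n′ ℕ.≟ m′ ℕ.+ n
    ... | no _  = nothing
    ... | yes e = just (begin
      ι m - ι n                   ≈⟨ x+z-[y+z]≈x-y (ι m) (ι n) (ι n′) ⟨
      (ι m + ι n′) - (ι n + ι n′) ≈⟨ +-cong ιm+ιn′≈ιm′+ιn (-‿cong (+-comm (ι n) (ι n′))) ⟩
      (ι m′ + ι n) - (ι n′ + ι n) ≈⟨ x+z-[y+z]≈x-y (ι m′) (ι n′) (ι n) ⟩
      ι m′ - ι n′                 ∎)
      where
      ιm+ιn′≈ιm′+ιn : ι m + ι n′ ≈ ι m′ + ι n
      ιm+ιn′≈ιm′+ιn = trans (sym (ι-homo-+ m n′)) (trans (reflexive (≡.cong ι e)) (ι-homo-+ m′ n))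

  open import Algebra.Solver.Ring ℤ-rawRing (fromCommutativeRing R) morphism _≟ℤ_ public

module LinearAlgebra {c ℓ} (R : CommutativeRing c ℓ) where
  open CommutativeRing R
  open FieldDefs R
  open IntegerCoefficientSolver R
  open import Algebra.Properties.Group +-group using (x∙y⁻¹≈ε⇒x≈y; x≈y⇒x∙y⁻¹≈ε; ε⁻¹≈ε)
  open import Relation.Binary.Reasoning.Setoid setoid

  infix 4 _≋_
  _≋_ : ∀ {n} → Vect n → Vect n → Set ℓ
  u ≋ v = ∀ j → u j ≈ v j

  combination : ∀ {n} → Carrier → Carrier → Pair n → Vect n
  combination a b (x , y) j = a * x j + b * y j

  combination-cong : ∀ {n} {a a′ b b′} {x x′ y y′ : Vect n} → a ≈ a′ → b ≈ b′ → x ≋ x′ → y ≋ y′ →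
                     combination a b (x , y) ≋ combination a′ b′ (x′ , y′)
  combination-cong a≈a′ b≈b′ x≈x′ y≈y′ j = +-cong (*-cong a≈a′ (x≈x′ j)) (*-cong b≈b′ (y≈y′ j))

  combination-cong-coefficients : ∀ {n} {a a′ b b′} → a ≈ a′ → b ≈ b′ → ∀ (P : Pair n) →
                                  combination a b P ≋ combination a′ b′ P
  combination-cong-coefficients a≈a′ b≈b′ (x , y) j = +-cong (*-congʳ a≈a′) (*-congʳ b≈b′)

  combination-zero : ∀ {n} (P : Pair n) {a b} → a ≈ 0# → b ≈ 0# → combination a b P ≋ λ _ → 0#
  combination-zero (x , y) a≈0 b≈0 j =
    trans (+-cong (trans (*-congʳ a≈0) (zeroˡ (x j))) (trans (*-congʳ b≈0) (zeroˡ (y j)))) (+-identityʳ 0#)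

  Nonzero⇒coefficients≉0 : ∀ {n} {u : Vect n} P {a b} → Nonzero u → u ≋ combination a b P → ¬ (a ≈ 0# × b ≈ 0#)
  Nonzero⇒coefficients≉0 P u≉0 u≋ (a≈0 , b≈0) = u≉0 (λ j → trans (u≋ j) (combination-zero P a≈0 b≈0 j))

  Indep⇒coefficients-unique : ∀ {n} {P : Pair n} → Indep P → ∀ {a b a′ b′} →
    combination a b P ≋ combination a′ b′ P → (a ≈ a′) × (b ≈ b′)
  Indep⇒coefficients-unique {P = x , y} indep {a} {b} {a′} {b′} same =
    let a-a′≈0 , b-b′≈0 = indep (a - a′) (b - b′) difference≈0
    in x∙y⁻¹≈ε⇒x≈y a a′ a-a′≈0 , x∙y⁻¹≈ε⇒x≈y b b′ b-b′≈0
    where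
    difference≈0 : ∀ j → (a - a′) * x j + (b - b′) * y j ≈ 0#
    difference≈0 j = trans
      (solve 6 (λ a b a′ b′ x y → (a :- a′) :* x :+ (b :- b′) :* y := (a :* x :+ b :* y) :- (a′ :* x :+ b′ :* y))
             refl a b a′ b′ (x j) (y j))
      (x≈y⇒x∙y⁻¹≈ε (same j))

  private
    unit : Fin 2 → Vect 2
    unit 0F 0F = 1#
    unit 0F 1F = 0#
    unit 1F 0F = 0#
    unit 1F 1F = 1#

  -- If (x , y) reaches both unit vectors with coefficient matrix N, then
  -- det [x y] · det N ≈ 1, so det [x y] kills no nonzero element.
  spanning⇒Indep : ∀ {x y : Vect 2} → (∀ v → InSpan v (x , y)) → Indep (x , y)
  spanning⇒Indep {x} {y} spans a b ax+by≈0
    with spans (unit 0F) | spans (unit 1F)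
  ... | s₀ , t₀ , e₀≈ | s₁ , t₁ , e₁≈ = det-cancel a Da≈0 , det-cancel b Db≈0
    where
    D E : Carrier
    D = x 0F * y 1F - y 0F * x 1F
    E = s₀ * t₁ - s₁ * t₀

    DE≈1 : D * E ≈ 1#
    DE≈1 = begin
      D * E ≈⟨ solve 8 (λ x₀ x₁ y₀ y₁ s₀ t₀ s₁ t₁ →
                 (x₀ :* y₁ :- y₀ :* x₁) :* (s₀ :* t₁ :- s₁ :* t₀)
                 := (s₀ :* x₀ :+ t₀ :* y₀) :* (s₁ :* x₁ :+ t₁ :* y₁) :- (s₁ :* x₀ :+ t₁ :* y₀) :* (s₀ :* x₁ :+ t₀ :* y₁))
               refl (x 0F) (x 1F) (y 0F) (y 1F) s₀ t₀ s₁ t₁ ⟩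
      (s₀ * x 0F + t₀ * y 0F) * (s₁ * x 1F + t₁ * y 1F) - (s₁ * x 0F + t₁ * y 0F) * (s₀ * x 1F + t₀ * y 1F)
        ≈⟨ +-cong (*-cong (sym (e₀≈ 0F)) (sym (e₁≈ 1F))) (-‿cong (*-cong (sym (e₁≈ 0F)) (sym (e₀≈ 1F)))) ⟩
      1# * 1# - 0# * 0# ≈⟨ +-cong (*-identityʳ 1#) (-‿cong (zeroʳ 0#)) ⟩
      1# - 0#           ≈⟨ +-congˡ ε⁻¹≈ε ⟩
      1# + 0#           ≈⟨ +-identityʳ 1# ⟩
      1# ∎

    det-cancel : ∀ z → D * z ≈ 0# → z ≈ 0#
    det-cancel z Dz≈0 = begin
      z             ≈⟨ *-identityˡ z ⟨
      1# * z        ≈⟨ *-congʳ DE≈1 ⟨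
      (D * E) * z   ≈⟨ solve 3 (λ D E z → (D :* E) :* z := E :* (D :* z)) refl D E z ⟩
      E * (D * z)   ≈⟨ *-congˡ Dz≈0 ⟩
      E * 0#        ≈⟨ zeroʳ E ⟩
      0#            ∎

    Da≈0 : D * a ≈ 0#
    Da≈0 = begin
      D * a ≈⟨ solve 6 (λ x₀ x₁ y₀ y₁ a b → (x₀ :* y₁ :- y₀ :* x₁) :* a
                        := y₁ :* (a :* x₀ :+ b :* y₀) :- y₀ :* (a :* x₁ :+ b :* y₁))
               refl (x 0F) (x 1F) (y 0F) (y 1F) a b ⟩
      y 1F * (a * x 0F + b * y 0F) - y 0F * (a * x 1F + b * y 1F) ≈⟨ +-cong (*-congˡ (ax+by≈0 0F)) (-‿cong (*-congˡ (ax+by≈0 1F))) ⟩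
      y 1F * 0# - y 0F * 0# ≈⟨ +-cong (zeroʳ _) (-‿cong (zeroʳ _)) ⟩
      0# - 0#               ≈⟨ -‿inverseʳ 0# ⟩
      0# ∎

    Db≈0 : D * b ≈ 0#
    Db≈0 = begin
      D * b ≈⟨ solve 6 (λ x₀ x₁ y₀ y₁ a b → (x₀ :* y₁ :- y₀ :* x₁) :* b
                        := x₀ :* (a :* x₁ :+ b :* y₁) :- x₁ :* (a :* x₀ :+ b :* y₀))
               refl (x 0F) (x 1F) (y 0F) (y 1F) a b ⟩
      x 0F * (a * x 1F + b * y 1F) - x 1F * (a * x 0F + b * y 0F) ≈⟨ +-cong (*-congˡ (ax+by≈0 1F)) (-‿cong (*-congˡ (ax+by≈0 0F))) ⟩
      x 0F * 0# - x 1F * 0# ≈⟨ +-cong (zeroʳ _) (-‿cong (zeroʳ _)) ⟩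
      0# - 0#               ≈⟨ -‿inverseʳ 0# ⟩
      0# ∎

  SameSpan-≋ : ∀ {n} {x x′ y y′ : Vect n} → x ≋ x′ → y ≋ y′ → SameSpan (x , y) (x′ , y′)
  SameSpan-≋ x≋x′ y≋y′ v =
    (λ (a , b , v≋) → a , b , λ j → trans (v≋ j) (combination-cong refl refl x≋x′ y≋y′ j)) ,
    (λ (a , b , v≋) → a , b , λ j → trans (v≋ j) (combination-cong refl refl (sym ∘ x≋x′) (sym ∘ y≋y′) j))

  SameSpan-refl : ∀ {n} {P : Pair n} → SameSpan P P
  SameSpan-refl = SameSpan-≋ (λ _ → refl) (λ _ → refl)

  _++ᴾ_ : ∀ {m n} → Pair m → Pair n → Pair (m ℕ.+ n)
  (x , y) ++ᴾ (z , w) = x ++ z , y ++ w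

  ≋-by-halves : ∀ m {n} {u v : Vect (m ℕ.+ n)} → take m u ≋ take m v → drop m u ≋ drop m v → u ≋ v
  ≋-by-halves m {n} {u} {v} take≋ drop≋ k =
    ≡.subst (λ k → u k ≈ v k) (join-splitAt m n k)
            ([_,_] {C = λ s → u (join m n s) ≈ v (join m n s)} take≋ drop≋ (splitAt m k))

  ++-congʳ : ∀ {m n} (x : Vect m) {z z′ : Vect n} → z ≋ z′ → x ++ z ≋ x ++ z′
  ++-congʳ {m} x z≋z′ k with splitAt m k
  ... | inj₁ j = refl
  ... | inj₂ r = z≋z′ r

  take-combination-++ᴾ : ∀ {m n} a b (P : Pair m) (Q : Pair n) →
                         take m (combination a b (P ++ᴾ Q)) ≋ combination a b P
  take-combination-++ᴾ a b (x , y) (z , w) j =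
    reflexive (≡.cong₂ (λ p p′ → a * p + b * p′) (lookup-++ˡ x z j) (lookup-++ˡ y w j))

  drop-combination-++ᴾ : ∀ {m n} a b (P : Pair m) (Q : Pair n) →
                         drop m (combination a b (P ++ᴾ Q)) ≋ combination a b Q
  drop-combination-++ᴾ a b (x , y) (z , w) r =
    reflexive (≡.cong₂ (λ p p′ → a * p + b * p′) (lookup-++ʳ x z r) (lookup-++ʳ y w r))

  InSpan-++ᴾ⁻ : ∀ {m n} {v : Vect (m ℕ.+ n)} {P : Pair m} {Q : Pair n} → InSpan v (P ++ᴾ Q) →
                ∃₂ λ a b → take m v ≋ combination a b P × drop m v ≋ combination a b Q
  InSpan-++ᴾ⁻ {m} {n} {P = P} {Q} (a , b , v≋) =
    a , b , (λ j → trans (v≋ (j ↑ˡ n)) (take-combination-++ᴾ a b P Q j))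
          , (λ r → trans (v≋ (m ↑ʳ r)) (drop-combination-++ᴾ a b P Q r))

  InSpan-++ᴾ⁺ : ∀ {m n} {v : Vect (m ℕ.+ n)} {P : Pair m} {Q : Pair n} a b →
                take m v ≋ combination a b P → drop m v ≋ combination a b Q → InSpan v (P ++ᴾ Q)
  InSpan-++ᴾ⁺ {m} {P = P} {Q} a b take≋ drop≋ =
    a , b , ≋-by-halves m (λ j → trans (take≋ j) (sym (take-combination-++ᴾ a b P Q j)))
                          (λ r → trans (drop≋ r) (sym (drop-combination-++ᴾ a b P Q r)))

  IsSpreadOn : ∀ n {I : Set} → (I → Pair n) → Set (c ⊔ ℓ)
  IsSpreadOn n S =
    (∀ k → Indep (S k)) ×
    (∀ v → Nonzero v → ∃ λ k → InSpan v (S k) × (∀ k′ → InSpan v (S k′) → k′ ≡ k))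

  IsSpreadOn-↔ : ∀ {n N} {I : Set} {S : I → Pair n} (e : Fin N ↔ I) →
                 IsSpreadOn n S → IsSpread n N (S ∘ Inverse.to e)
  IsSpreadOn-↔ {S = S} e (indep , unique) = indep ∘ to , λ v v≉0 →
    let t , v∈St , St-unique = unique v v≉0 in
    from t , ≡.subst (InSpan v ∘ S) (≡.sym (strictlyInverseˡ t)) v∈St ,
    λ k v∈Sk → ≡.trans (≡.sym (strictlyInverseʳ k)) (≡.cong from (St-unique (to k) v∈Sk))
    where open Inverse e

module Field {c ℓ} (R : CommutativeRing c ℓ) (isField : FieldDefs.IsField R) where
  open CommutativeRing R
  open FieldDefs R
  open IntegerCoefficientSolver R
  open import Relation.Binary.Reasoning.Setoid setoid

  inverse : ∀ {x} → x ≉ 0# → Carrier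
  inverse x≉0 = proj₁ (proj₂ isField _ x≉0)

  *-inverseʳ : ∀ {x} (x≉0 : x ≉ 0#) → x * inverse x≉0 ≈ 1#
  *-inverseʳ x≉0 = proj₂ (proj₂ isField _ x≉0)

  x*[y*x⁻¹]≈y : ∀ {x} (x≉0 : x ≉ 0#) y → x * (y * inverse x≉0) ≈ y
  x*[y*x⁻¹]≈y {x} x≉0 y = begin
    x * (y * x⁻¹) ≈⟨ solve 3 (λ x y x⁻¹ → x :* (y :* x⁻¹) := y :* (x :* x⁻¹)) refl x y x⁻¹ ⟩
    y * (x * x⁻¹) ≈⟨ *-congˡ (*-inverseʳ x≉0) ⟩
    y * 1#        ≈⟨ *-identityʳ y ⟩
    y             ∎
    where x⁻¹ = inverse x≉0

  *-cancelˡ : ∀ {x y z} → x ≉ 0# → x * y ≈ x * z → y ≈ z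
  *-cancelˡ {x} {y} {z} x≉0 xy≈xz = begin
    y                 ≈⟨ *-identityʳ y ⟨
    y * 1#            ≈⟨ *-congˡ (*-inverseʳ x≉0) ⟨
    y * (x * x⁻¹)     ≈⟨ solve 3 (λ x y x⁻¹ → y :* (x :* x⁻¹) := (x :* y) :* x⁻¹) refl x y x⁻¹ ⟩
    (x * y) * x⁻¹     ≈⟨ *-congʳ xy≈xz ⟩
    (x * z) * x⁻¹     ≈⟨ solve 3 (λ x z x⁻¹ → (x :* z) :* x⁻¹ := z :* (x :* x⁻¹)) refl x z x⁻¹ ⟩
    z * (x * x⁻¹)     ≈⟨ *-congˡ (*-inverseʳ x≉0) ⟩
    z * 1#            ≈⟨ *-identityʳ z ⟩
    z                 ∎
    where x⁻¹ = inverse x≉0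

  *-nonzero : ∀ {x y} → x ≉ 0# → y ≉ 0# → x * y ≉ 0#
  *-nonzero {x} x≉0 y≉0 xy≈0 = y≉0 (*-cancelˡ x≉0 (trans xy≈0 (sym (zeroʳ x))))

  inverse-nonzero : ∀ {x} (x≉0 : x ≉ 0#) → inverse x≉0 ≉ 0#
  inverse-nonzero {x} x≉0 x⁻¹≈0 = proj₁ isField (trans (sym (*-inverseʳ x≉0)) (trans (*-congˡ x⁻¹≈0) (zeroʳ x)))

  pow-nonzero : ∀ {x} → x ≉ 0# → ∀ n → pow x n ≉ 0#
  pow-nonzero x≉0 zero    = proj₁ isField
  pow-nonzero x≉0 (suc n) = *-nonzero x≉0 (pow-nonzero x≉0 n)

module Powers {c ℓ} (R : CommutativeRing c ℓ) where
  open CommutativeRing R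
  open FieldDefs R

  pow-collision⇒bounded : ∀ {x i j} → pow x i ≈ pow x j → i < j →
                          ∀ k → ∃ λ m → m < j × pow x k ≈ pow x m
  pow-collision⇒bounded {j = suc _} xⁱ≈xʲ i<j zero = 0 , s≤s z≤n , refl
  pow-collision⇒bounded {x} {i} {j} xⁱ≈xʲ i<j (suc k)
    with pow-collision⇒bounded xⁱ≈xʲ i<j k
  ... | m , m<j , xᵏ≈xᵐ with m≤n⇒m<n∨m≡n m<j
  ...   | inj₁ 1+m<j = suc m , 1+m<j , *-congˡ xᵏ≈xᵐ
  ...   | inj₂ ≡.refl = i , i<j , trans (*-congˡ xᵏ≈xᵐ) (sym xⁱ≈xʲ)

pigeonhole-avoiding : ∀ {n} (f : Fin n → Fin n) (c : Fin n) → (∀ i → f i ≢ c) →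
                      ∃₂ λ i j → i Fin.< j × f i ≡ f j
pigeonhole-avoiding {suc n} f c f≢c =
  let i , j , i<j , eq = pigeonhole (n<1+n n) (λ i → punchOut (f≢c i ∘ ≡.sym))
  in i , j , i<j , punchOut-injective (f≢c i ∘ ≡.sym) (f≢c j ∘ ≡.sym) eq

module FiniteField {c ℓ} (R : CommutativeRing c ℓ) (isField : FieldDefs.IsField R)
                   (q : ℕ) (card : FieldDefs.HasCard R q) where
  open CommutativeRing R
  open FieldDefs R
  open Field R isField using (pow-nonzero)
  open Powers R
  open Bijection card using (strictlySurjective; injective) renaming (to to element; cong to element-cong)

  index : Carrier → Fin q
  index x = proj₁ (strictlySurjective x)

  element-index : ∀ x → element (index x) ≈ x
  element-index x = proj₂ (strictlySurjective x)

  index-unique : ∀ {i x} → element i ≈ x → i ≡ index x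
  index-unique {x = x} i≈x = injective (trans i≈x (sym (element-index x)))

  index-injective : ∀ {x y} → index x ≡ index y → x ≈ y
  index-injective {x} {y} eq = trans (sym (element-index x)) (trans (element-cong eq) (element-index y))

  _≟_ : Decidable _≈_
  x ≟ y with index x Fin.≟ index y
  ... | yes eq = yes (index-injective eq)
  ... | no neq = no (λ x≈y → neq (index-unique (trans (element-index x) x≈y)))

  -- The q powers x⁰ … x^(q-1) are nonzero, and there are only q - 1 nonzero elements.
  pow-collision : ∀ {x} → x ≉ 0# → ∃₂ λ i j → i < j × j < q × pow x i ≈ pow x j
  pow-collision {x} x≉0 =
    let i , j , i<j , eq = pigeonhole-avoiding (λ i → index (pow x (toℕ i))) (index 0#)
                             (λ i eq → pow-nonzero x≉0 (toℕ i) (index-injective eq))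
    in toℕ i , toℕ j , i<j , toℕ<n j , index-injective eq

  primitive-power : ∀ {α} → IsPrimitive α → ∀ {x} → x ≉ 0# →
                    ∃ λ m → 2 ℕ.+ m ≤ q × x ≈ pow α m
  primitive-power (α≉0 , generates) {x} x≉0 =
    let k , x≈αᵏ = generates x x≉0
        i , j , i<j , j<q , αⁱ≈αʲ = pow-collision α≉0
        m , m<j , αᵏ≈αᵐ = pow-collision⇒bounded αⁱ≈αʲ i<j k
    in m , ≤-trans (s≤s m<j) j<q , trans x≈αᵏ αᵏ≈αᵐ

module ExtensionCode {c ℓ} (R : CommutativeRing c ℓ) (isField : FieldDefs.IsField R)
  (q : ℕ) (card : FieldDefs.HasCard R q)
  (α : CommutativeRing.Carrier R) (α-primitive : FieldDefs.IsPrimitive R α)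
  (B₁ B₂ : FieldDefs.Mat R q) (code : FieldDefs.IsExtensionCode R q α B₁ B₂)
  (i₁ i₂ : Fin (suc q)) (i₁≡0 : toℕ i₁ ≡ 0) (i₂≡1 : toℕ i₂ ≡ 1) where
  open CommutativeRing R
  open FieldDefs R
  open IntegerCoefficientSolver R
  open LinearAlgebra R
  open Field R isField
  open FiniteField R isField q card using (_≟_; primitive-power)
  open import Relation.Binary.Reasoning.Setoid setoid

  columnPair : Fin (suc q) → Pair 2
  columnPair k = column B₁ k , column B₂ k

  firstColumns : Mat q → Pair 2
  firstColumns Z = column Z i₁ , column Z i₂

  lin-cong : ∀ {s s′ t t′} → s ≈ s′ → t ≈ t′ → ∀ r k → lin B₁ B₂ s t r k ≈ lin B₁ B₂ s′ t′ r k
  lin-cong s≈s′ t≈t′ r k = +-cong (*-congʳ s≈s′) (*-congʳ t≈t′)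

  columnPair-spans : ∀ k v → InSpan v (columnPair k)
  columnPair-spans k v = let s , t , col≈v = proj₂ (proj₂ code) k v in s , t , λ r → sym (col≈v r)

  column-recurrence : ∀ m (2+m≤q : 2 ℕ.+ m ≤ q) s t r →
    lin B₁ B₂ s t r (fromℕ< (s≤s 2+m≤q)) ≈ pow α m * lin B₁ B₂ s t r i₁ + lin B₁ B₂ s t r i₂
  column-recurrence m 2+m≤q s t r =
    ≡.subst (λ n → lin B₁ B₂ s t r k ≈ pow α (n ℕ.∸ 2) * lin B₁ B₂ s t r i₁ + lin B₁ B₂ s t r i₂)
            toℕk≡2+m (proj₁ (proj₂ code) s t i₁ i₂ k i₁≡0 i₂≡1 2≤toℕk r)
    where
    k = fromℕ< (s≤s 2+m≤q)
    toℕk≡2+m : toℕ k ≡ 2 ℕ.+ m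
    toℕk≡2+m = toℕ-fromℕ< (s≤s 2+m≤q)
    2≤toℕk : 2 ≤ toℕ k
    2≤toℕk = ≡.subst (2 ≤_) (≡.sym toℕk≡2+m) (s≤s (s≤s z≤n))

  -- a z₁ + b z₂ = b (α^m z₁ + z₂) = b z_(m+2), the last step being the extension rule.
  combination-as-column : ∀ {a b} (b≉0 : b ≉ 0#) {m} (2+m≤q : 2 ℕ.+ m ≤ q) → a * inverse b≉0 ≈ pow α m →
    ∀ s t → combination a b (firstColumns (lin B₁ B₂ s t)) ≋ (λ r → b * lin B₁ B₂ s t r (fromℕ< (s≤s 2+m≤q)))
  combination-as-column {a} {b} b≉0 {m} 2+m≤q a/b≈αᵐ s t r = begin
    a * z₁ + b * z₂            ≈⟨ +-congʳ (*-congʳ (x*[y*x⁻¹]≈y b≉0 a)) ⟨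
    (b * a/b) * z₁ + b * z₂    ≈⟨ solve 4 (λ b c z₁ z₂ → (b :* c) :* z₁ :+ b :* z₂ := b :* (c :* z₁ :+ z₂)) refl b a/b z₁ z₂ ⟩
    b * (a/b * z₁ + z₂)        ≈⟨ *-congˡ (+-congʳ (*-congʳ a/b≈αᵐ)) ⟩
    b * (pow α m * z₁ + z₂)    ≈⟨ *-congˡ (column-recurrence m 2+m≤q s t r) ⟨
    b * lin B₁ B₂ s t r (fromℕ< (s≤s 2+m≤q)) ∎
    where
    z₁ = lin B₁ B₂ s t r i₁
    z₂ = lin B₁ B₂ s t r i₂
    a/b = a * inverse b≉0

  firstColumns-combination : ∀ {a b} → ¬ (a ≈ 0# × b ≈ 0#) → ∃₂ λ d k → d ≉ 0# ×
    ∀ s t → combination a b (firstColumns (lin B₁ B₂ s t)) ≋ (λ r → d * lin B₁ B₂ s t r k)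
  firstColumns-combination {a} {b} ab≉0 with b ≟ 0# | a ≟ 0#
  ... | yes b≈0 | _ = a , i₁ , (λ a≈0 → ab≉0 (a≈0 , b≈0)) , λ s t r →
    trans (+-congˡ (trans (*-congʳ b≈0) (zeroˡ _))) (+-identityʳ _)
  ... | no b≉0 | yes a≈0 = b , i₂ , b≉0 , λ s t r →
    trans (+-congʳ (trans (*-congʳ a≈0) (zeroˡ _))) (+-identityˡ _)
  ... | no b≉0 | no a≉0 =
    let m , 2+m≤q , a/b≈αᵐ = primitive-power α-primitive (*-nonzero a≉0 (inverse-nonzero b≉0))
    in b , fromℕ< (s≤s 2+m≤q) , b≉0 , combination-as-column b≉0 2+m≤q a/b≈αᵐ

  firstColumns-surjective : ∀ {a b} → ¬ (a ≈ 0# × b ≈ 0#) → ∀ w →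
    ∃₂ λ s t → w ≋ combination a b (firstColumns (lin B₁ B₂ s t))
  firstColumns-surjective {a} {b} ab≉0 w =
    let d , k , d≉0 , comb≋ = firstColumns-combination ab≉0
        s , t , w/d≋ = columnPair-spans k (λ r → inverse d≉0 * w r)
    in s , t , λ r → begin
      w r                                    ≈⟨ x*[y*x⁻¹]≈y d≉0 (w r) ⟨
      d * (w r * inverse d≉0)                ≈⟨ *-congˡ (*-comm (w r) _) ⟩
      d * (inverse d≉0 * w r)                ≈⟨ *-congˡ (w/d≋ r) ⟩
      d * lin B₁ B₂ s t r k                  ≈⟨ comb≋ s t r ⟨
      combination a b (firstColumns (lin B₁ B₂ s t)) r ∎

  firstColumns-injective : ∀ {a b} → ¬ (a ≈ 0# × b ≈ 0#) → ∀ {s t s′ t′} →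
    combination a b (firstColumns (lin B₁ B₂ s t)) ≋ combination a b (firstColumns (lin B₁ B₂ s′ t′)) →
    (s ≈ s′) × (t ≈ t′)
  firstColumns-injective ab≉0 {s} {t} {s′} {t′} same =
    let d , k , d≉0 , comb≋ = firstColumns-combination ab≉0
    in Indep⇒coefficients-unique (spanning⇒Indep (columnPair-spans k))
         (λ r → *-cancelˡ d≉0 (trans (sym (comb≋ s t r)) (trans (same r) (comb≋ s′ t′ r))))

Fin[q⁴+q²+1]↔ : ∀ q → Fin (q ℕ.^ 4 ℕ.+ q ℕ.^ 2 ℕ.+ 1) ↔ (Fin (q ℕ.^ 2 ℕ.+ 1) × (Fin q × Fin q) ⊎ ⊤)
Fin[q⁴+q²+1]↔ q = ↔-trans +↔⊎ (↔-trans (Fin-cong q⁴+q²≡[q²+1]q²) (↔-trans *↔× (↔-refl ×-↔ *↔×)) ⊎-↔ 1↔⊤)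
  where
  open import Data.Nat.Solver using (module +-*-Solver)
  open +-*-Solver
  q⁴+q²≡[q²+1]q² : q ℕ.^ 4 ℕ.+ q ℕ.^ 2 ≡ (q ℕ.^ 2 ℕ.+ 1) ℕ.* (q ℕ.* q)
  q⁴+q²≡[q²+1]q² = solve 1 (λ q → q :^ 4 :+ q :^ 2 := (q :^ 2 :+ con 1) :* (q :* q)) ≡.refl q
  Fin-cong : ∀ {m n} → m ≡ n → Fin m ↔ Fin n
  Fin-cong ≡.refl = ↔-refl

module ExtendedSpread {c ℓ} (R : CommutativeRing c ℓ) (isField : FieldDefs.IsField R)
  (q : ℕ) (card : FieldDefs.HasCard R q)
  (α : CommutativeRing.Carrier R) (α-primitive : FieldDefs.IsPrimitive R α)
  (A : Fin (q ℕ.^ 2 ℕ.+ 1) → FieldDefs.Pair R 4) (A-spread : FieldDefs.IsSpread R 4 (q ℕ.^ 2 ℕ.+ 1) A)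
  (B₁ B₂ : FieldDefs.Mat R q) (code : FieldDefs.IsExtensionCode R q α B₁ B₂)
  (i₁ i₂ : Fin (suc q)) (i₁≡0 : toℕ i₁ ≡ 0) (i₂≡1 : toℕ i₂ ≡ 1) where
  open CommutativeRing R
  open FieldDefs R
  open LinearAlgebra R
  open FiniteField R isField q card using (_≟_; index; element-index; index-unique)
  open ExtensionCode R isField q card α α-primitive B₁ B₂ code i₁ i₂ i₁≡0 i₂≡1
  open Bijection card using () renaming (to to element)

  MemberIndex : Set
  MemberIndex = Fin (q ℕ.^ 2 ℕ.+ 1) × (Fin q × Fin q) ⊎ ⊤

  codeword : Fin q × Fin q → Mat q
  codeword (i , j) = lin B₁ B₂ (element i) (element j)

  member : MemberIndex → Pair 6
  member (inj₁ (X , ij)) = extend (A X) (codeword ij) i₁ i₂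
  member (inj₂ tt)       = e₅ , e₆

  take-combination-e₅e₆ : ∀ a b → take 4 (combination a b (e₅ , e₆)) ≋ λ _ → 0#
  take-combination-e₅e₆ a b j = trans (+-cong (*-congˡ (e₅-lower j)) (*-congˡ (e₆-lower j))) a*0+b*0≈0
    where
    e₅-lower : ∀ j → e₅ (j ↑ˡ 2) ≈ 0#
    e₅-lower 0F = refl
    e₅-lower 1F = refl
    e₅-lower 2F = refl
    e₅-lower 3F = refl
    e₆-lower : ∀ j → e₆ (j ↑ˡ 2) ≈ 0#
    e₆-lower 0F = refl
    e₆-lower 1F = refl
    e₆-lower 2F = refl
    e₆-lower 3F = refl
    a*0+b*0≈0 : a * 0# + b * 0# ≈ 0#
    a*0+b*0≈0 = trans (+-cong (zeroʳ a) (zeroʳ b)) (+-identityʳ 0#)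

  drop-combination-e₅e₆ : ∀ a b → drop 4 (combination a b (e₅ , e₆)) ≋ (a ∷ b ∷ [])
  drop-combination-e₅e₆ a b 0F = trans (+-cong (*-identityʳ a) (zeroʳ b)) (+-identityʳ a)
  drop-combination-e₅e₆ a b 1F = trans (+-cong (zeroʳ a) (*-identityʳ b)) (+-identityˡ b)

  InSpan-e₅e₆⁻ : ∀ {v : Vect 6} → InSpan v (e₅ , e₆) → take 4 v ≋ λ _ → 0#
  InSpan-e₅e₆⁻ (a , b , v≋) j = trans (v≋ (j ↑ˡ 2)) (take-combination-e₅e₆ a b j)

  InSpan-e₅e₆⁺ : ∀ {v : Vect 6} → take 4 v ≋ (λ _ → 0#) → InSpan v (e₅ , e₆)
  InSpan-e₅e₆⁺ {v} lower≈0 = a , b , ≋-by-halves 4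
    (λ j → trans (lower≈0 j) (sym (take-combination-e₅e₆ a b j)))
    (λ { 0F → sym (drop-combination-e₅e₆ a b 0F) ; 1F → sym (drop-combination-e₅e₆ a b 1F) })
    where
    a = drop 4 v 0F
    b = drop 4 v 1F

  member-indep : ∀ t → Indep (member t)
  member-indep (inj₁ (X , ij)) a b comb≈0 =
    proj₁ A-spread X a b (λ j → trans (sym (take-combination-++ᴾ a b (A X) (firstColumns (codeword ij)) j)) (comb≈0 (j ↑ˡ 2)))
  member-indep (inj₂ tt) a b comb≈0 =
    trans (sym (drop-combination-e₅e₆ a b 0F)) (comb≈0 (4 ↑ʳ 0F)) , trans (sym (drop-combination-e₅e₆ a b 1F)) (comb≈0 (4 ↑ʳ 1F))

  InSpan-member⁻ : ∀ {v X ij} → InSpan v (member (inj₁ (X , ij))) →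
    ∃₂ λ a b → take 4 v ≋ combination a b (A X) × drop 4 v ≋ combination a b (firstColumns (codeword ij))
  InSpan-member⁻ {X = X} {ij} = InSpan-++ᴾ⁻ {P = A X} {Q = firstColumns (codeword ij)}

  member-lower≈0-unique : ∀ {v} → Nonzero v → take 4 v ≋ (λ _ → 0#) →
                          ∀ t → InSpan v (member t) → t ≡ inj₂ tt
  member-lower≈0-unique v≉0 lower≈0 (inj₂ tt) _ = ≡.refl
  member-lower≈0-unique v≉0 lower≈0 (inj₁ (X , ij)) v∈ =
    let a , b , lower≋ , upper≋ = InSpan-member⁻ {X = X} {ij} v∈
        a≈0 , b≈0 = proj₁ A-spread X a b (λ j → trans (sym (lower≋ j)) (lower≈0 j))
    in ⊥-elim (v≉0 (≋-by-halves 4 lower≈0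
         (λ r → trans (upper≋ r) (combination-zero (firstColumns (codeword ij)) a≈0 b≈0 r))))

  codeword-unique : ∀ {a b s t i j} → ¬ (a ≈ 0# × b ≈ 0#) →
    combination a b (firstColumns (lin B₁ B₂ s t)) ≋ combination a b (firstColumns (codeword (i , j))) →
    (i , j) ≡ (index s , index t)
  codeword-unique ab≉0 same =
    let s≈i , t≈j = firstColumns-injective ab≉0 same in
    ≡.cong₂ _,_ (index-unique (sym s≈i)) (index-unique (sym t≈j))

  -- Within X_Z the lower coefficients (a , b) are fixed by X, and then Z by
  -- injectivity of (s , t) ↦ a z₁ + b z₂.
  member-lower≉0-unique : ∀ {v X a b s t} → take 4 v ≋ combination a b (A X) →
    drop 4 v ≋ combination a b (firstColumns (lin B₁ B₂ s t)) → Nonzero (take 4 v) →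
    (∀ X′ → InSpan (take 4 v) (A X′) → X′ ≡ X) →
    ∀ t′ → InSpan v (member t′) → t′ ≡ inj₁ (X , index s , index t)
  member-lower≉0-unique lower≋ upper≋ lower≉0 X-unique (inj₂ tt) v∈ = ⊥-elim (lower≉0 (InSpan-e₅e₆⁻ v∈))
  member-lower≉0-unique {v} {X} {a} {b} lower≋ upper≋ lower≉0 X-unique (inj₁ (X′ , ij)) v∈ =
    let a′ , b′ , lower≋′ , upper≋′ = InSpan-member⁻ {X = X′} {ij} v∈
        X′≡X = X-unique X′ (a′ , b′ , lower≋′)
        a≈a′ , b≈b′ = Indep⇒coefficients-unique {P = A X} (proj₁ A-spread X)
          (λ j → trans (sym (lower≋ j)) (≡.subst (λ Y → take 4 v ≋ combination a′ b′ (A Y)) X′≡X lower≋′ j))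
    in ≡.cong₂ (λ Y ij → inj₁ (Y , ij)) X′≡X
         (codeword-unique (Nonzero⇒coefficients≉0 (A X) lower≉0 lower≋)
           (λ r → trans (sym (upper≋ r)) (trans (upper≋′ r)
                    (combination-cong-coefficients (sym a≈a′) (sym b≈b′) (firstColumns (codeword ij)) r))))

  member-lower≉0 : ∀ {v} → Nonzero (take 4 v) →
    (∃ λ X → InSpan (take 4 v) (A X) × (∀ X′ → InSpan (take 4 v) (A X′) → X′ ≡ X)) →
    ∃ λ t → InSpan v (member t) × (∀ t′ → InSpan v (member t′) → t′ ≡ t)
  member-lower≉0 {v} lower≉0 (X , (a , b , lower≋) , X-unique) =
    let s , t , upper≋ = firstColumns-surjective (Nonzero⇒coefficients≉0 (A X) lower≉0 lower≋) (drop 4 v)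
        element-index-column : ∀ k r → lin B₁ B₂ s t r k ≈ codeword (index s , index t) r k
        element-index-column k r = lin-cong (sym (element-index s)) (sym (element-index t)) r k
    in inj₁ (X , index s , index t)
     , InSpan-++ᴾ⁺ {P = A X} {Q = firstColumns (codeword (index s , index t))} a b lower≋
         (λ r → trans (upper≋ r) (combination-cong refl refl (element-index-column i₁) (element-index-column i₂) r))
     , member-lower≉0-unique lower≋ upper≋ lower≉0 X-unique

  member-unique : ∀ v → Nonzero v → ∃ λ t → InSpan v (member t) × (∀ t′ → InSpan v (member t′) → t′ ≡ t)
  member-unique v v≉0 with all? (λ j → take 4 v j ≟ 0#)
  ... | yes lower≈0 = inj₂ tt , InSpan-e₅e₆⁺ lower≈0 , member-lower≈0-unique v≉0 lower≈0
  ... | no lower≉0  = member-lower≉0 lower≉0 (proj₂ A-spread (take 4 v) lower≉0)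

  S : Fin (q ℕ.^ 4 ℕ.+ q ℕ.^ 2 ℕ.+ 1) → Pair 6
  S = member ∘ Inverse.to (Fin[q⁴+q²+1]↔ q)

  S-spread : IsSpread 6 (q ℕ.^ 4 ℕ.+ q ℕ.^ 2 ℕ.+ 1) S
  S-spread = IsSpreadOn-↔ (Fin[q⁴+q²+1]↔ q) (member-indep , member-unique)

  member-kind : ∀ t → SameSpan (member t) (e₅ , e₆) ⊎
                      (∃ λ X → ∃₂ λ a b → SameSpan (member t) (extend (A X) (lin B₁ B₂ a b) i₁ i₂))
  member-kind (inj₁ (X , i , j)) = inj₂ (X , element i , element j , SameSpan-refl)
  member-kind (inj₂ tt)          = inj₁ SameSpan-refl

  S-kind : ∀ k → SameSpan (S k) (e₅ , e₆) ⊎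
                 (∃ λ X → ∃₂ λ a b → SameSpan (S k) (extend (A X) (lin B₁ B₂ a b) i₁ i₂))
  S-kind = member-kind ∘ Inverse.to (Fin[q⁴+q²+1]↔ q)

  S-lists : ∀ t → ∃ λ k → S k ≡ member t
  S-lists t = from t , ≡.cong member (strictlyInverseˡ t)
    where open Inverse (Fin[q⁴+q²+1]↔ q)

  S-lists-e₅e₆ : ∃ λ k → SameSpan (S k) (e₅ , e₆)
  S-lists-e₅e₆ =
    let k , Sk≡ = S-lists (inj₂ tt)
    in k , ≡.subst (λ P → SameSpan P (e₅ , e₆)) (≡.sym Sk≡) SameSpan-refl

  S-lists-extensions : ∀ X a b → ∃ λ k → SameSpan (S k) (extend (A X) (lin B₁ B₂ a b) i₁ i₂)
  S-lists-extensions X a b =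
    let k , Sk≡ = S-lists (inj₁ (X , index a , index b))
    in k , ≡.subst (λ P → SameSpan P (extend (A X) (lin B₁ B₂ a b) i₁ i₂)) (≡.sym Sk≡)
          (SameSpan-≋ (++-congʳ (proj₁ (A X)) (index-column i₁)) (++-congʳ (proj₂ (A X)) (index-column i₂)))
    where
    index-column : ∀ k r → codeword (index a , index b) r k ≈ lin B₁ B₂ a b r k
    index-column k r = lin-cong (element-index a) (element-index b) r k

lemma18 : ∀ {c ℓ} (R : CommutativeRing c ℓ) → (q : ℕ) → IsPrimePower q →
    FieldDefs.IsField R → FieldDefs.HasCard R q →
    (α : CommutativeRing.Carrier R) → FieldDefs.IsPrimitive R α →
    (A : Fin (q ℕ.^ 2 ℕ.+ 1) → FieldDefs.Pair R 4) → FieldDefs.IsSpread R 4 (q ℕ.^ 2 ℕ.+ 1) A →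
    (B₁ B₂ : FieldDefs.Mat R q) → FieldDefs.IsExtensionCode R q α B₁ B₂ →
    (i₁ i₂ : Fin (suc q)) → toℕ i₁ ≡ 0 → toℕ i₂ ≡ 1 →
    FieldDefs.ExtendedIsSpread R q A B₁ B₂ i₁ i₂
lemma18 R q _ isField card α α-primitive A A-spread B₁ B₂ code i₁ i₂ i₁≡0 i₂≡1 =
  S , S-spread , S-kind , S-lists-e₅e₆ , S-lists-extensions
  where open ExtendedSpread R isField q card α α-primitive A A-spread B₁ B₂ code i₁ i₂ i₁≡0 i₂≡1
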